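{- Let $G$ be a finite simple undirected graph, let $V_k\subseteq V(G)$ be a vertex cover of $G$ with $|V_k|=k$, and let $M(G,V_k)$ be the graph obtained from $G$ by adding, for each non-empty subset $X\subseteq V_k$, a new vertex $M_X$ whose neighborhood is exactly $X$. Let $\Omega$ be a potential maximal clique of $M(G,V_k)$. Then $V_k$ intersects at most three distinct connected components of $M(G,V_k)\setminus\Omega$.
   Context: A vertex cover is a vertex set meeting every edge. For a graph $H$ and $\Omega\subseteq V(H)$, $H\setminus\Omega$ is the subgraph induced by $V(H)\setminus\Omega$. A triangulation of $H$ is a chordal graph on $V(H)$ containing $E(H)$; it is minimal if no triangulation has an edge set that is a proper subset of its edge set. A potential maximal clique (PMC) of $H$ is a maximal clique of some minimal triangulation of $H$. -}

module Defs where

open import Data.Nat using (ℕ; zero; suc; _≤_)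
open import Data.Bool using (Bool; true; false; T; not)
open import Data.Fin using (Fin; toℕ)
open import Data.Fin.Subset using (Subset; _∈_; _⊆_; Nonempty; ∣_∣)
open import Data.Fin.Subset.Properties using (nonempty?; _⊆?_)
open import Data.Vec using (lookup)
open import Data.Product using (Σ; ∃; _×_; _,_)
open import Data.Sum using (_⊎_; inj₁; inj₂)
open import Relation.Nullary using (¬_; Dec; yes; no)
open import Relation.Nullary.Decidable using (⌊_⌋)
open import Relation.Binary.PropositionalEquality using (_≡_; _≢_; refl)

record Graph (V : Set) : Set where
  field
    adj    : V → V → Bool
    sym    : ∀ u v → adj u v ≡ adj v u
    irrefl : ∀ v → adj v v ≡ false

open Graph public

Adj : ∀ {V} → Graph V → V → V → Set
Adj H u v = T (adj H u v)

VSet : Set → Set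
VSet V = V → Bool

Consec : ∀ {k} → Fin k → Fin k → Set
Consec {k} i j = (suc (toℕ i) ≡ toℕ j) ⊎ (suc (toℕ i) ≡ k × toℕ j ≡ 0)

IsCycle : ∀ {V} → Graph V → (k : ℕ) → (Fin k → V) → Set
IsCycle H k c =
  (∀ i j → c i ≡ c j → i ≡ j) × (∀ i j → Consec i j → Adj H (c i) (c j))

HasChord : ∀ {V} → Graph V → (k : ℕ) → (Fin k → V) → Set
HasChord H k c =
  ∃ λ i → ∃ λ j → i ≢ j × ¬ Consec i j × ¬ Consec j i × Adj H (c i) (c j)

Chordal : ∀ {V} → Graph V → Set
Chordal {V} H = ∀ (k : ℕ) (c : Fin k → V) → 4 ≤ k → IsCycle H k c → HasChord H k c

EdgeSub : ∀ {V} → Graph V → Graph V → Set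
EdgeSub H₁ H₂ = ∀ u v → Adj H₁ u v → Adj H₂ u v

IsTriangulation : ∀ {V} → Graph V → Graph V → Set
IsTriangulation G H = Chordal H × EdgeSub G H

IsMinimalTriangulation : ∀ {V} → Graph V → Graph V → Set
IsMinimalTriangulation {V} G H =
  IsTriangulation G H ×
  (∀ (H' : Graph V) → IsTriangulation G H' → EdgeSub H' H → EdgeSub H H')

IsClique : ∀ {V} → Graph V → VSet V → Set
IsClique H S = ∀ u v → T (S u) → T (S v) → u ≢ v → Adj H u v

IsMaximalClique : ∀ {V} → Graph V → VSet V → Set
IsMaximalClique {V} H S =
  IsClique H S ×
  (∀ (S' : VSet V) → IsClique H S' → (∀ v → T (S v) → T (S' v)) →
     ∀ v → T (S' v) → T (S v))

IsPMC : ∀ {V} → Graph V → VSet V → Set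
IsPMC {V} G Ω = ∃ λ (H : Graph V) → IsMinimalTriangulation G H × IsMaximalClique H Ω

data Reach {V} (H : Graph V) (Ω : VSet V) : V → V → Set where
  stop : ∀ {v} → T (not (Ω v)) → Reach H Ω v v
  step : ∀ {u w v} → T (not (Ω u)) → Adj H u w → Reach H Ω w v → Reach H Ω u v

IsComponent : ∀ {V} → Graph V → VSet V → VSet V → Set
IsComponent H Ω C =
  (∃ λ v → T (C v)) ×
  (∀ u v → T (C u) → T (C v) → Reach H Ω u v) ×
  (∀ u v → T (C u) → Reach H Ω u v → T (C v))

IsVertexCover : ∀ {n} → Graph (Fin n) → Subset n → Set
IsVertexCover G S = ∀ u v → Adj G u v → u ∈ S ⊎ v ∈ S

-- vertices of M(G,S): old vertices, plus one vertex M_X for each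
-- non-empty X ⊆ S
MVert : ∀ n → Subset n → Set
MVert n S = Fin n ⊎ Σ (Subset n) (λ X → T ⌊ nonempty? X ⌋ × T ⌊ X ⊆? S ⌋)

private
  madj : ∀ {n} {S : Subset n} → Graph (Fin n) → MVert n S → MVert n S → Bool
  madj G (inj₁ u) (inj₁ v) = adj G u v
  madj G (inj₁ u) (inj₂ (X , _)) = lookup X u
  madj G (inj₂ (X , _)) (inj₁ v) = lookup X v
  madj G (inj₂ _) (inj₂ _) = false

  msym : ∀ {n} {S : Subset n} (G : Graph (Fin n)) (a b : MVert n S) →
         madj G a b ≡ madj G b a
  msym G (inj₁ u) (inj₁ v) = sym G u v
  msym G (inj₁ u) (inj₂ _) = refl
  msym G (inj₂ _) (inj₁ v) = refl
  msym G (inj₂ _) (inj₂ _) = refl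

  mirr : ∀ {n} {S : Subset n} (G : Graph (Fin n)) (a : MVert n S) → madj G a a ≡ false
  mirr G (inj₁ u) = irrefl G u
  mirr G (inj₂ _) = refl

M : ∀ {n} → Graph (Fin n) → (S : Subset n) → Graph (MVert n S)
M G S = record { adj = madj G ; sym = msym G ; irrefl = mirr G }

Meets : ∀ {n} {S : Subset n} → VSet (MVert n S) → Set
Meets {n} {S} C = ∃ λ (v : Fin n) → v ∈ S × T (C (inj₁ v))

-- Suppose four distinct components C₁, …, C₄ of M ∖ Ω contain vertices a₁, …, a₄ of V_k.
-- The added vertices x = M_{a₁a₂} and y = M_{a₃a₄} each join two different components,
-- so both lie in Ω, and xy is an edge of any minimal triangulation H with clique Ω.
-- Call C₁ ∪ C₂ ∪ {x} inside, Ω ∖ {x, y} separator and everything else outside: no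
-- edge of M joins inside to outside. Removing the inside–outside edges of H keeps it
-- chordal, since a cycle of the smaller graph with an inside–outside chord in H passes
-- through the clique Ω ∖ {x, y} on both of its arcs, which yields a surviving chord.
-- By minimality H has no inside–outside edge, contradicting xy ∈ E(H).

module Submission where

open import Defs hiding (sym)
open import Data.Nat using (ℕ)
open import Data.Fin using (Fin)
open import Data.Fin.Subset using (Subset; ∣_∣)
open import Data.Sum using (_⊎_)
open import Relation.Binary.PropositionalEquality using (_≡_; _≗_)

open import Data.Bool using (Bool; true; false; T; not; _∧_; _∨_)
open import Data.Bool.Properties using (T-∧; T-∨; T-≡; T?; T-irrelevant; ⇔→≡)
import Data.Bool.Properties as Bool
open import Data.Empty using (⊥; ⊥-elim)
open import Data.Fin using (toℕ; fromℕ<)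
open import Data.Fin.Properties using (toℕ-fromℕ<; fromℕ<-toℕ; toℕ<n; toℕ-injective)
import Data.Fin.Properties as Fin
open import Data.Fin.Subset using (_∈_; _⊆_; ⁅_⁆; _∪_)
open import Data.Fin.Subset.Properties using (_⊆?_; x∈⁅x⁆; x∈⁅y⁆⇒x≡y; x∈p∪q⁺; x∈p∪q⁻)
open import Data.Nat using (zero; suc; _≤_; _<_; z≤n; s≤s; z<s; s≤s⁻¹; _<?_)
open import Data.Nat.Properties
  using (suc-injective; ≤-refl; <-trans; <⇒≤; n<1+n; m<n⇒m<1+n; m≤n⇒m<n∨m≡n; ≤∧≢⇒<; <-cmp; <⇒≢; <-irrefl; <-asym; ≤-<-trans; <-≤-trans)
open import Data.Product using (∃; ∃₂; _×_; _,_; proj₁; proj₂)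
import Data.Product.Properties as Σ
open import Data.Sum using (inj₁; inj₂; [_,_])
import Data.Sum
import Data.Sum.Properties as Sum
open import Data.Sum.Properties using (inj₁-injective)
open import Data.Vec using (lookup)
open import Data.Vec.Properties using ([]=⇒lookup; lookup⇒[]=)
import Data.Vec.Properties as Vec
open import Function using (_∘_)
open import Function.Bundles using (Equivalence; mk⇔)
import Function.Properties.Equivalence as ⇔
open import Relation.Binary.Definitions using (DecidableEquality; tri<; tri≈; tri>)
open import Relation.Binary.PropositionalEquality using (_≢_; refl; sym; trans; cong; cong₂; subst; subst₂)
open import Relation.Nullary using (¬_; yes; no; contradiction)
open import Relation.Nullary.Decidable using (⌊_⌋; toWitness; fromWitness)

¬T⇒T-not : ∀ {b} → ¬ T b → T (not b)
¬T⇒T-not {false} _  = _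
¬T⇒T-not {true}  ¬t = ¬t _

T-not⇒¬T : ∀ {b} → T (not b) → ¬ T b
T-not⇒¬T {false} _ ()

∈⇒T-lookup : ∀ {n} {p : Subset n} {x} → x ∈ p → T (lookup p x)
∈⇒T-lookup x∈p = Equivalence.from T-≡ ([]=⇒lookup x∈p)

T-lookup⇒∈ : ∀ {n} {p : Subset n} {x} → T (lookup p x) → x ∈ p
T-lookup⇒∈ {p = p} {x} t = lookup⇒[]= x p (Equivalence.to T-≡ t)

data Part : Set where
  inside separator outside : Part

compatible : Part → Part → Bool
compatible inside  outside = false
compatible outside inside  = false
compatible _       _       = true

Compatible : Part → Part → Set
Compatible A B = T (compatible A B)

compatible-sym : ∀ A B → compatible A B ≡ compatible B A
compatible-sym inside    inside    = refl
compatible-sym inside    separator = refl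
compatible-sym inside    outside   = refl
compatible-sym separator inside    = refl
compatible-sym separator separator = refl
compatible-sym separator outside   = refl
compatible-sym outside   inside    = refl
compatible-sym outside   separator = refl
compatible-sym outside   outside   = refl

compatible-refl : ∀ A → Compatible A A
compatible-refl inside    = _
compatible-refl separator = _
compatible-refl outside   = _

compatible-separator : ∀ A → Compatible A separator
compatible-separator inside    = _
compatible-separator separator = _
compatible-separator outside   = _

incompatible-sym : ∀ {A B} → ¬ Compatible A B → ¬ Compatible B A
incompatible-sym {A} {B} = subst (λ b → ¬ T b) (compatible-sym A B)

incompatible-trichotomy : ∀ {A B} → ¬ Compatible A B → ∀ L → L ≡ separator ⊎ L ≡ A ⊎ L ≡ B
incompatible-trichotomy         _ separator = inj₁ refl
incompatible-trichotomy {inside}  {outside} _ inside  = inj₂ (inj₁ refl)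
incompatible-trichotomy {inside}  {outside} _ outside = inj₂ (inj₂ refl)
incompatible-trichotomy {outside} {inside}  _ inside  = inj₂ (inj₂ refl)
incompatible-trichotomy {outside} {inside}  _ outside = inj₂ (inj₁ refl)
incompatible-trichotomy {inside}    {inside}    ¬c _ = contradiction _ ¬c
incompatible-trichotomy {inside}    {separator} ¬c _ = contradiction _ ¬c
incompatible-trichotomy {separator}             ¬c _ = contradiction _ ¬c
incompatible-trichotomy {outside}   {separator} ¬c _ = contradiction _ ¬c
incompatible-trichotomy {outside}   {outside}   ¬c _ = contradiction _ ¬c

compatible-unless-across : ∀ A B → (A ≡ inside → B ≡ outside → ⊥) → (A ≡ outside → B ≡ inside → ⊥) →
                           Compatible A B
compatible-unless-across inside    inside    _ _ = _
compatible-unless-across inside    separator _ _ = _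
compatible-unless-across inside    outside   h _ = h refl refl
compatible-unless-across separator _         _ _ = _
compatible-unless-across outside   inside    _ h = h refl refl
compatible-unless-across outside   separator _ _ = _
compatible-unless-across outside   outside   _ _ = _

classify : Bool → Bool → Part
classify true  _     = inside
classify false true  = separator
classify false false = outside

classify-inside : ∀ {a b} → classify a b ≡ inside → T a
classify-inside {true} _ = _
classify-inside {false} {true} ()
classify-inside {false} {false} ()

classify-separator : ∀ {a b} → classify a b ≡ separator → T b
classify-separator {true} ()
classify-separator {false} {true} _ = _
classify-separator {false} {false} ()

classify-outside : ∀ {a b} → classify a b ≡ outside → ¬ T a × ¬ T b
classify-outside {true} ()
classify-outside {false} {true} ()
classify-outside {false} {false} _ = (λ ()) , (λ ())

module _ (g : ℕ → Part) where

  separator-between : ∀ {a b} → a ≤ b → (∀ m → a ≤ m → m < b → Compatible (g m) (g (suc m))) →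
                      ¬ Compatible (g a) (g b) → ∃ λ t → a < t × t < b × g t ≡ separator
  separator-between {a} {zero} z≤n _ ¬c = contradiction (compatible-refl (g 0)) ¬c
  separator-between {a} {suc b} a≤1+b compat ¬c with m≤n⇒m<n∨m≡n a≤1+b
  ... | inj₂ refl = contradiction (compatible-refl (g a)) ¬c
  ... | inj₁ (s≤s a≤b) with incompatible-trichotomy ¬c (g b)
  ...   | inj₁ gb≡sep = b , ≤∧≢⇒< a≤b a≢b , n<1+n b , gb≡sep
    where
    a≢b : a ≢ b
    a≢b refl = ¬c (subst (λ A → Compatible A (g (suc b))) (sym gb≡sep) _)
  ...   | inj₂ (inj₁ gb≡ga) =
    contradiction (subst (λ A → Compatible A (g (suc b))) gb≡ga (compat b a≤b (n<1+n b))) ¬c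
  ...   | inj₂ (inj₂ gb≡g1+b) with separator-between a≤b
                                  (λ m a≤m m<b → compat m a≤m (m<n⇒m<1+n m<b))
                                  (subst (λ B → ¬ Compatible (g a) B) (sym gb≡g1+b) ¬c)
  ...     | t , a<t , t<b , gt = t , a<t , m<n⇒m<1+n t<b , gt

module _ (K : ℕ) (g : ℕ → Part)
         (next : ∀ m → m < K → Compatible (g m) (g (suc m)))
         (wrap : Compatible (g K) (g 0)) where

  private
    between : ∀ {a b} → a ≤ b → b ≤ K → ¬ Compatible (g a) (g b) →
              ∃ λ t → a < t × t < b × g t ≡ separator
    between a≤b b≤K = separator-between g a≤b (λ m _ m<b → next m (<-≤-trans m<b b≤K))

  -- Positions 0 and K are consecutive around the cycle, hence the condition 0 < s ⊎ t < K.
  SeparatorsApart : Set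
  SeparatorsApart = ∃₂ λ s t → suc s < t × t ≤ K × (0 < s ⊎ t < K) × g s ≡ separator × g t ≡ separator

  separators-on-both-arcs : ∀ {i j} → i < j → j ≤ K → ¬ Compatible (g i) (g j) → SeparatorsApart
  separators-on-both-arcs {i} {j} i<j j≤K ¬c with between (<⇒≤ i<j) j≤K ¬c
  ... | t₁ , i<t₁ , t₁<j , gt₁ = through-K (incompatible-trichotomy ¬c (g K))
    where
    0<t₁ : 0 < t₁
    0<t₁ = ≤-<-trans z≤n i<t₁

    t₁<K : t₁ < K
    t₁<K = <-≤-trans t₁<j j≤K

    through-0 : g K ≡ g j → g 0 ≡ separator ⊎ g 0 ≡ g i ⊎ g 0 ≡ g j → SeparatorsApart
    through-0 _ (inj₁ g0≡sep) = 0 , t₁ , ≤-<-trans 0<i i<t₁ , <⇒≤ t₁<K , inj₂ t₁<K , g0≡sep , gt₁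
      where
      0<i : 0 < i
      0<i = ≤∧≢⇒< z≤n λ { refl → ¬c (subst (λ A → Compatible A (g j)) (sym g0≡sep) _) }
    through-0 gK≡gj (inj₂ (inj₁ g0≡gi)) = contradiction (subst₂ Compatible gK≡gj g0≡gi wrap) (incompatible-sym ¬c)
    through-0 _ (inj₂ (inj₂ g0≡gj))
      with between z≤n (<⇒≤ (<-≤-trans i<j j≤K)) (subst (λ A → ¬ Compatible A (g i)) (sym g0≡gj) (incompatible-sym ¬c))
    ... | t₂ , _ , t₂<i , gt₂ = t₂ , t₁ , ≤-<-trans t₂<i i<t₁ , <⇒≤ t₁<K , inj₂ t₁<K , gt₂ , gt₁

    through-K : g K ≡ separator ⊎ g K ≡ g i ⊎ g K ≡ g j → SeparatorsApart
    through-K (inj₁ gK≡sep) = t₁ , K , ≤-<-trans t₁<j j<K , ≤-refl , inj₁ 0<t₁ , gt₁ , gK≡sep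
      where
      j<K : j < K
      j<K = ≤∧≢⇒< j≤K λ { refl → ¬c (subst (Compatible (g i)) (sym gK≡sep) (compatible-separator (g i))) }
    through-K (inj₂ (inj₁ gK≡gi))
      with between j≤K ≤-refl (subst (λ B → ¬ Compatible (g j) B) (sym gK≡gi) (incompatible-sym ¬c))
    ... | t₂ , j<t₂ , t₂<K , gt₂ = t₁ , t₂ , ≤-<-trans t₁<j j<t₂ , <⇒≤ t₂<K , inj₁ 0<t₁ , gt₁ , gt₂
    through-K (inj₂ (inj₂ gK≡gj)) = through-0 gK≡gj (incompatible-trichotomy ¬c (g 0))

Apart : ∀ {k} → Fin k → Fin k → Set
Apart s t = s ≢ t × ¬ Consec s t × ¬ Consec t s

apart : ∀ {K a b} {s t : Fin (suc K)} → toℕ s ≡ a → toℕ t ≡ b →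
        suc a < b → 0 < a ⊎ b < K → Apart s t
apart {s = s} {t} refl refl 1+s<t far = s≢t , s↛t , t↛s
  where
  s<t : toℕ s < toℕ t
  s<t = <-trans (n<1+n (toℕ s)) 1+s<t
  s≢t : s ≢ t
  s≢t refl = <-irrefl refl s<t
  s↛t : ¬ Consec s t
  s↛t (inj₁ 1+s≡t) = <-irrefl 1+s≡t 1+s<t
  s↛t (inj₂ (_ , t≡0)) = <⇒≢ (≤-<-trans z≤n s<t) (sym t≡0)
  t↛s : ¬ Consec t s
  t↛s (inj₁ 1+t≡s) = <-asym s<t (subst (toℕ t <_) 1+t≡s (n<1+n (toℕ t)))
  t↛s (inj₂ (1+t≡1+K , s≡0)) = [ (λ 0<s → <⇒≢ 0<s (sym s≡0)) , (λ t<K → <⇒≢ t<K (suc-injective 1+t≡1+K)) ] far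

atPosition : ∀ {K} → (Fin (suc K) → Part) → ℕ → Part
atPosition {K} f m with m <? suc K
... | yes m<1+K = f (fromℕ< m<1+K)
... | no _      = separator

atPosition-fromℕ< : ∀ {K} (f : Fin (suc K) → Part) {m} (m<1+K : m < suc K) →
                    atPosition f m ≡ f (fromℕ< m<1+K)
atPosition-fromℕ< {K} f {m} m<1+K with m <? suc K
... | yes _     = refl
... | no m≮1+K = contradiction m<1+K m≮1+K

atPosition-toℕ : ∀ {K} (f : Fin (suc K) → Part) (i : Fin (suc K)) → atPosition f (toℕ i) ≡ f i
atPosition-toℕ f i = trans (atPosition-fromℕ< f (toℕ<n i)) (cong f (fromℕ<-toℕ i (toℕ<n i)))

separators-on-cycle : ∀ {K} (f : Fin (suc K) → Part) →
                      (∀ i j → Consec i j → Compatible (f i) (f j)) →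
                      ∀ i j → ¬ Compatible (f i) (f j) →
                      ∃₂ λ s t → f s ≡ separator × f t ≡ separator × Apart s t
separators-on-cycle {K} f compat = chord
  where
  g : ℕ → Part
  g = atPosition f

  g-compat : ∀ {m n} (m<1+K : m < suc K) (n<1+K : n < suc K) →
             Consec (fromℕ< m<1+K) (fromℕ< n<1+K) → Compatible (g m) (g n)
  g-compat m<1+K n<1+K c =
    subst₂ Compatible (sym (atPosition-fromℕ< f m<1+K)) (sym (atPosition-fromℕ< f n<1+K)) (compat _ _ c)

  next : ∀ m → m < K → Compatible (g m) (g (suc m))
  next m m<K = g-compat (m<n⇒m<1+n m<K) (s≤s m<K)
                 (inj₁ (trans (cong suc (toℕ-fromℕ< _)) (sym (toℕ-fromℕ< (s≤s m<K)))))

  wrap : Compatible (g K) (g 0)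
  wrap = g-compat (n<1+n K) z<s (inj₂ (cong suc (toℕ-fromℕ< (n<1+n K)) , refl))

  ordered : ∀ {a b} → a < b → b ≤ K → ¬ Compatible (g a) (g b) →
            ∃₂ λ s t → f s ≡ separator × f t ≡ separator × Apart s t
  ordered a<b b≤K ¬c with separators-on-both-arcs K g next wrap a<b b≤K ¬c
  ... | s , t , 1+s<t , t≤K , far , gs , gt =
    fromℕ< s<1+K , fromℕ< (s≤s t≤K) ,
    trans (sym (atPosition-fromℕ< f s<1+K)) gs ,
    trans (sym (atPosition-fromℕ< f (s≤s t≤K))) gt ,
    apart (toℕ-fromℕ< s<1+K) (toℕ-fromℕ< (s≤s t≤K)) 1+s<t far
    where
    s<1+K : s < suc K
    s<1+K = m<n⇒m<1+n (<-≤-trans (<-trans (n<1+n s) 1+s<t) t≤K)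

  g-toℕ : ∀ i j → ¬ Compatible (f i) (f j) → ¬ Compatible (g (toℕ i)) (g (toℕ j))
  g-toℕ i j = subst₂ (λ A B → ¬ Compatible A B) (sym (atPosition-toℕ f i)) (sym (atPosition-toℕ f j))

  chord : ∀ i j → ¬ Compatible (f i) (f j) → ∃₂ λ s t → f s ≡ separator × f t ≡ separator × Apart s t
  chord i j ¬c with <-cmp (toℕ i) (toℕ j)
  ... | tri< i<j _ _ = ordered i<j (s≤s⁻¹ (toℕ<n j)) (g-toℕ i j ¬c)
  ... | tri> _ _ j<i = ordered j<i (s≤s⁻¹ (toℕ<n i)) (g-toℕ j i (incompatible-sym ¬c))
  ... | tri≈ _ i≡j _ = contradiction (subst (λ k → Compatible (f i) (f k)) (toℕ-injective i≡j) (compatible-refl (f i))) ¬c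

dropIncompatible : ∀ {V} → Graph V → (V → Part) → Graph V
dropIncompatible H part = record
  { adj    = λ u v → adj H u v ∧ compatible (part u) (part v)
  ; sym    = λ u v → cong₂ _∧_ (Graph.sym H u v) (compatible-sym (part u) (part v))
  ; irrefl = λ v → cong (_∧ compatible (part v) (part v)) (irrefl H v)
  }

module _ {V : Set} (H : Graph V) (part : V → Part) where

  dropIncompatible-adj⁻ : ∀ {u v} → Adj (dropIncompatible H part) u v → Adj H u v × Compatible (part u) (part v)
  dropIncompatible-adj⁻ = Equivalence.to T-∧

  dropIncompatible-adj⁺ : ∀ {u v} → Adj H u v → Compatible (part u) (part v) → Adj (dropIncompatible H part) u v
  dropIncompatible-adj⁺ uv c = Equivalence.from T-∧ (uv , c)

  dropIncompatible-chordal : Chordal H →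
                             (∀ u v → part u ≡ separator → part v ≡ separator → u ≢ v → Adj H u v) →
                             Chordal (dropIncompatible H part)
  dropIncompatible-chordal chordal separators-adjacent zero c () _
  dropIncompatible-chordal chordal separators-adjacent (suc K) c 4≤k (injective , edges)
    with chordal (suc K) c 4≤k (injective , λ i j ij → proj₁ (dropIncompatible-adj⁻ (edges i j ij)))
  ... | i , j , i≢j , i↛j , j↛i , cᵢcⱼ with T? (compatible (part (c i)) (part (c j)))
  ...   | yes compat = i , j , i≢j , i↛j , j↛i , dropIncompatible-adj⁺ cᵢcⱼ compat
  ...   | no incompat
    with separators-on-cycle (part ∘ c) (λ i j ij → proj₂ (dropIncompatible-adj⁻ (edges i j ij))) i j incompat
  ...     | s , t , sep-s , sep-t , s≢t , s↛t , t↛s =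
    s , t , s≢t , s↛t , t↛s ,
    dropIncompatible-adj⁺ (separators-adjacent (c s) (c t) sep-s sep-t (s≢t ∘ injective s t))
                          (subst₂ Compatible (sym sep-s) (sym sep-t) _)

minimalTriangulation-compatible :
  ∀ {V} {G H : Graph V} → IsMinimalTriangulation G H → (part : V → Part) →
  (∀ u v → part u ≡ separator → part v ≡ separator → u ≢ v → Adj H u v) →
  (∀ u v → Adj G u v → Compatible (part u) (part v)) →
  ∀ u v → Adj H u v → Compatible (part u) (part v)
minimalTriangulation-compatible {G = G} {H} ((chordal , G⊆H) , minimal) part separators-adjacent G-compatible u v uv =
  proj₂ (dropIncompatible-adj⁻ H part (minimal H′ (chordal′ , G⊆H′) H′⊆H u v uv))
  where
  H′ = dropIncompatible H part
  chordal′ : Chordal H′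
  chordal′ = dropIncompatible-chordal H part chordal separators-adjacent
  G⊆H′ : EdgeSub G H′
  G⊆H′ u v uv = dropIncompatible-adj⁺ H part (G⊆H u v uv) (G-compatible u v uv)
  H′⊆H : EdgeSub H′ H
  H′⊆H u v = proj₁ ∘ dropIncompatible-adj⁻ H part

module _ {V : Set} {H : Graph V} {Ω : VSet V} where

  reach-avoids : ∀ {u v} → Reach H Ω u v → T (not (Ω u))
  reach-avoids (stop u∉Ω)     = u∉Ω
  reach-avoids (step u∉Ω _ _) = u∉Ω

  component-avoids : ∀ {C} → IsComponent H Ω C → ∀ {u} → T (C u) → T (not (Ω u))
  component-avoids (_ , connected , _) {u} u∈C = reach-avoids (connected u u u∈C u∈C)

  component-closed : ∀ {C} → IsComponent H Ω C → ∀ {u v} → T (C u) → Adj H u v → T (not (Ω v)) → T (C v)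
  component-closed C@(_ , _ , closed) {u} {v} u∈C uv v∉Ω =
    closed u v u∈C (step (component-avoids C u∈C) uv (stop v∉Ω))

  component-≗ : ∀ {C D} → IsComponent H Ω C → IsComponent H Ω D → ∀ {u} → T (C u) → T (D u) → C ≗ D
  component-≗ {C} {D} (_ , C-connected , C-closed) (_ , D-connected , D-closed) {u} u∈C u∈D w =
    ⇔→≡ (⇔.trans (⇔.sym T-≡) (⇔.trans (mk⇔ C⇒D D⇒C) T-≡))
    where
    C⇒D : T (C w) → T (D w)
    C⇒D w∈C = D-closed u w u∈D (C-connected u w u∈C w∈C)
    D⇒C : T (D w) → T (C w)
    D⇒C w∈D = C-closed u w u∈C (D-connected u w u∈D w∈D)

  component-≗-or-avoids : ∀ {C D} → IsComponent H Ω C → IsComponent H Ω D → ∀ {u} → T (D u) → C ≗ D ⊎ ¬ T (C u)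
  component-≗-or-avoids {C} C-comp D-comp {u} u∈D with T? (C u)
  ... | yes u∈C = inj₁ (component-≗ C-comp D-comp u∈C u∈D)
  ... | no  u∉C = inj₂ u∉C

  common-neighbour-in-separator : ∀ {C} → IsComponent H Ω C → ∀ {u v w} → T (C u) → ¬ T (C v) →
                                  T (not (Ω v)) → Adj H u w → Adj H w v → T (Ω w)
  common-neighbour-in-separator C {w = w} u∈C v∉C v∉Ω uw wv with T? (Ω w)
  ... | yes w∈Ω = w∈Ω
  ... | no  w∉Ω = contradiction (component-closed C (component-closed C u∈C uw (¬T⇒T-not w∉Ω)) wv v∉Ω) v∉C

clique-pair-not-separated :
  ∀ {V} → DecidableEquality V → ∀ {G H : Graph V} {Ω U : VSet V} →
  IsMinimalTriangulation G H → IsClique H Ω →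
  (∀ u v → T (U u) → Adj G u v → T (not (Ω v)) → T (U v)) →
  ∀ {x y} → T (Ω x) → T (Ω y) → x ≢ y → ¬ T (U y) →
  (∀ v → Adj G x v → T (U v)) → (∀ u → T (U u) → ¬ Adj G u y) → ⊥
clique-pair-not-separated {V} _≟_ {G} {H} {Ω} {U} minimal clique U-closed {x} {y} x∈Ω y∈Ω x≢y y∉U N[x]⊆U U↛y =
  subst₂ Compatible part-x part-y x-y-compatible
  where
  part : V → Part
  part v = classify (U v ∨ ⌊ v ≟ x ⌋) (not ⌊ v ≟ y ⌋ ∧ Ω v)

  part-x : classify (U x ∨ ⌊ x ≟ x ⌋) (not ⌊ x ≟ y ⌋ ∧ Ω x) ≡ inside
  part-x with U x | x ≟ x
  ... | true  | _        = refl
  ... | false | yes _    = refl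
  ... | false | no x≢x  = contradiction refl x≢x

  part-y : classify (U y ∨ ⌊ y ≟ x ⌋) (not ⌊ y ≟ y ⌋ ∧ Ω y) ≡ outside
  part-y with U y | y ≟ x | y ≟ y
  ... | true  | _        | _       = ⊥-elim (y∉U _)
  ... | false | yes y≡x | _       = contradiction (sym y≡x) x≢y
  ... | false | no _     | yes _   = refl
  ... | false | no _     | no y≢y = contradiction refl y≢y

  inside-part : ∀ {v} → part v ≡ inside → T (U v) ⊎ v ≡ x
  inside-part e = Data.Sum.map₂ toWitness (Equivalence.to T-∨ (classify-inside e))

  outside-part : ∀ {v} → part v ≡ outside → ¬ T (U v) × (T (not (Ω v)) ⊎ v ≡ y)
  outside-part {v} e with classify-outside e
  ... | ¬inside , ¬separator = ¬inside ∘ Equivalence.from T-∨ ∘ inj₁ , outside-Ω ¬separator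
    where
    outside-Ω : ¬ T (not ⌊ v ≟ y ⌋ ∧ Ω v) → T (not (Ω v)) ⊎ v ≡ y
    outside-Ω ¬sep with v ≟ y
    ... | yes v≡y = inj₂ v≡y
    ... | no  _   = inj₁ (¬T⇒T-not ¬sep)

  separators-adjacent : ∀ u v → part u ≡ separator → part v ≡ separator → u ≢ v → Adj H u v
  separators-adjacent u v eu ev = clique u v (Ω-part eu) (Ω-part ev)
    where
    Ω-part : ∀ {w} → part w ≡ separator → T (Ω w)
    Ω-part = proj₂ ∘ Equivalence.to T-∧ ∘ classify-separator

  no-edge-across : ∀ {u v} → Adj G u v → part u ≡ inside → part v ≡ outside → ⊥
  no-edge-across {u} {v} uv eu ev with inside-part eu | outside-part ev
  ... | inj₁ u∈U | v∉U , inj₁ v∉Ω = v∉U (U-closed u v u∈U uv v∉Ω)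
  ... | inj₁ u∈U | _   , inj₂ refl = U↛y u u∈U uv
  ... | inj₂ refl | v∉U , _        = v∉U (N[x]⊆U v uv)

  G-compatible : ∀ u v → Adj G u v → Compatible (part u) (part v)
  G-compatible u v uv = compatible-unless-across (part u) (part v) (no-edge-across uv)
                          (λ eu ev → no-edge-across (subst T (Graph.sym G u v) uv) ev eu)

  x-y-compatible : Compatible (part x) (part y)
  x-y-compatible = minimalTriangulation-compatible {G = G} {H} minimal part separators-adjacent G-compatible x y
                     (clique x y x∈Ω y∈Ω x≢y)

module _ {n : ℕ} (G : Graph (Fin n)) (S : Subset n) where

  MVert-≟ : DecidableEquality (MVert n S)
  MVert-≟ = Sum.≡-dec Fin._≟_ (Σ.≡-dec (Vec.≡-dec Bool._≟_) (Σ.≡-dec T-≟ T-≟))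
    where
    T-≟ : ∀ {b} → DecidableEquality (T b)
    T-≟ p q = yes (T-irrelevant p q)

  pairVertex : ∀ {a b} → a ∈ S → b ∈ S → MVert n S
  pairVertex {a} {b} a∈S b∈S = inj₂ (⁅ a ⁆ ∪ ⁅ b ⁆ , fromWitness (a , a∈pair) , fromWitness {a? = _ ⊆? S} pair⊆S)
    where
    a∈pair : a ∈ ⁅ a ⁆ ∪ ⁅ b ⁆
    a∈pair = x∈p∪q⁺ (inj₁ (x∈⁅x⁆ a))
    pair⊆S : ⁅ a ⁆ ∪ ⁅ b ⁆ ⊆ S
    pair⊆S w∈pair with x∈p∪q⁻ ⁅ a ⁆ ⁅ b ⁆ w∈pair
    ... | inj₁ w∈⁅a⁆ = subst (_∈ S) (sym (x∈⁅y⁆⇒x≡y a w∈⁅a⁆)) a∈S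
    ... | inj₂ w∈⁅b⁆ = subst (_∈ S) (sym (x∈⁅y⁆⇒x≡y b w∈⁅b⁆)) b∈S

  module _ {a b} (a∈S : a ∈ S) (b∈S : b ∈ S) where

    pairVertex-adjˡ : Adj (M G S) (inj₁ a) (pairVertex a∈S b∈S)
    pairVertex-adjˡ = ∈⇒T-lookup (x∈p∪q⁺ {p = ⁅ a ⁆} {q = ⁅ b ⁆} (inj₁ (x∈⁅x⁆ a)))

    pairVertex-adjʳ : Adj (M G S) (pairVertex a∈S b∈S) (inj₁ b)
    pairVertex-adjʳ = ∈⇒T-lookup (x∈p∪q⁺ {p = ⁅ a ⁆} {q = ⁅ b ⁆} (inj₂ (x∈⁅x⁆ b)))

    pairVertex-neighbours : ∀ {v} → Adj (M G S) (pairVertex a∈S b∈S) v → v ≡ inj₁ a ⊎ v ≡ inj₁ b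
    pairVertex-neighbours {inj₁ w} xw =
      Data.Sum.map (cong inj₁ ∘ x∈⁅y⁆⇒x≡y a) (cong inj₁ ∘ x∈⁅y⁆⇒x≡y b) (x∈p∪q⁻ ⁅ a ⁆ ⁅ b ⁆ (T-lookup⇒∈ xw))

  pairVertex-≢ : ∀ {a b c d} (a∈S : a ∈ S) (b∈S : b ∈ S) (c∈S : c ∈ S) (d∈S : d ∈ S) →
                 a ≢ c → a ≢ d → pairVertex a∈S b∈S ≢ pairVertex c∈S d∈S
  pairVertex-≢ {a} a∈S b∈S c∈S d∈S a≢c a≢d x≡y =
    [ a≢c ∘ inj₁-injective , a≢d ∘ inj₁-injective ]
      (pairVertex-neighbours c∈S d∈S (subst (λ z → Adj (M G S) z (inj₁ a)) x≡y (pairVertex-adjˡ a∈S b∈S)))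

  pairVertex-in-separator :
    ∀ {Ω C D : VSet (MVert n S)} {a b} (a∈S : a ∈ S) (b∈S : b ∈ S) →
    IsComponent (M G S) Ω C → IsComponent (M G S) Ω D →
    T (C (inj₁ a)) → T (D (inj₁ b)) → ¬ T (C (inj₁ b)) → T (Ω (pairVertex a∈S b∈S))
  pairVertex-in-separator a∈S b∈S C D a∈C b∈D b∉C =
    common-neighbour-in-separator C a∈C b∉C (component-avoids D b∈D) (pairVertex-adjˡ a∈S b∈S) (pairVertex-adjʳ a∈S b∈S)

  no-four-separated-components :
    ∀ {H : Graph (MVert n S)} {Ω C₁ C₂ C₃ C₄ : VSet (MVert n S)} {a₁ a₂ a₃ a₄} →
    IsMinimalTriangulation (M G S) H → IsClique H Ω →
    IsComponent (M G S) Ω C₁ → IsComponent (M G S) Ω C₂ →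
    IsComponent (M G S) Ω C₃ → IsComponent (M G S) Ω C₄ →
    (a₁∈S : a₁ ∈ S) (a₂∈S : a₂ ∈ S) (a₃∈S : a₃ ∈ S) (a₄∈S : a₄ ∈ S) →
    T (C₁ (inj₁ a₁)) → T (C₂ (inj₁ a₂)) → T (C₃ (inj₁ a₃)) → T (C₄ (inj₁ a₄)) →
    ¬ T (C₁ (inj₁ a₂)) → ¬ T (C₃ (inj₁ a₄)) →
    ¬ T (C₁ (inj₁ a₃)) → ¬ T (C₁ (inj₁ a₄)) → ¬ T (C₂ (inj₁ a₃)) → ¬ T (C₂ (inj₁ a₄)) → ⊥
  no-four-separated-components {H} {Ω} {C₁} {C₂} minimal clique c₁ c₂ c₃ c₄ a₁∈S a₂∈S a₃∈S a₄∈S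
                               a₁∈C₁ a₂∈C₂ a₃∈C₃ a₄∈C₄ a₂∉C₁ a₄∉C₃ a₃∉C₁ a₄∉C₁ a₃∉C₂ a₄∉C₂ =
    clique-pair-not-separated MVert-≟ {M G S} {H} {Ω} {U} minimal clique U-closed x∈Ω y∈Ω x≢y y∉U N[x]⊆U U↛y
    where
    x y : MVert n S
    x = pairVertex a₁∈S a₂∈S
    y = pairVertex a₃∈S a₄∈S

    U : VSet (MVert n S)
    U v = C₁ v ∨ C₂ v

    x∈Ω : T (Ω x)
    x∈Ω = pairVertex-in-separator a₁∈S a₂∈S c₁ c₂ a₁∈C₁ a₂∈C₂ a₂∉C₁

    y∈Ω : T (Ω y)
    y∈Ω = pairVertex-in-separator a₃∈S a₄∈S c₃ c₄ a₃∈C₃ a₄∈C₄ a₄∉C₃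

    x≢y : x ≢ y
    x≢y = pairVertex-≢ a₁∈S a₂∈S a₃∈S a₄∈S (λ { refl → a₃∉C₁ a₁∈C₁ }) (λ { refl → a₄∉C₁ a₁∈C₁ })

    ∉U : ∀ {v} → ¬ T (C₁ v) → ¬ T (C₂ v) → ¬ T (U v)
    ∉U v∉C₁ v∉C₂ = [ v∉C₁ , v∉C₂ ] ∘ Equivalence.to T-∨

    U-closed : ∀ u v → T (U u) → Adj (M G S) u v → T (not (Ω v)) → T (U v)
    U-closed u v u∈U uv v∉Ω =
      Equivalence.from T-∨
        (Data.Sum.map (λ u∈C₁ → component-closed c₁ u∈C₁ uv v∉Ω) (λ u∈C₂ → component-closed c₂ u∈C₂ uv v∉Ω)
                      (Equivalence.to T-∨ u∈U))

    y∉U : ¬ T (U y)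
    y∉U = ∉U (λ y∈C₁ → T-not⇒¬T (component-avoids c₁ y∈C₁) y∈Ω) (λ y∈C₂ → T-not⇒¬T (component-avoids c₂ y∈C₂) y∈Ω)

    N[x]⊆U : ∀ v → Adj (M G S) x v → T (U v)
    N[x]⊆U v xv with pairVertex-neighbours a₁∈S a₂∈S {v} xv
    ... | inj₁ refl = Equivalence.from T-∨ (inj₁ a₁∈C₁)
    ... | inj₂ refl = Equivalence.from T-∨ (inj₂ a₂∈C₂)

    U↛y : ∀ u → T (U u) → ¬ Adj (M G S) u y
    U↛y u u∈U uy with pairVertex-neighbours a₃∈S a₄∈S {u} (subst T (Graph.sym (M G S) u y) uy)
    ... | inj₁ refl = ∉U a₃∉C₁ a₃∉C₂ u∈U
    ... | inj₂ refl = ∉U a₄∉C₁ a₄∉C₂ u∈U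

lemma4 : ∀ {n : ℕ} (G : Graph (Fin n)) (k : ℕ) (Vk : Subset n) →
         ∣ Vk ∣ ≡ k → IsVertexCover G Vk →
         (Ω : VSet (MVert n Vk)) → IsPMC (M G Vk) Ω →
         (C₁ C₂ C₃ C₄ : VSet (MVert n Vk)) →
         IsComponent (M G Vk) Ω C₁ → IsComponent (M G Vk) Ω C₂ →
         IsComponent (M G Vk) Ω C₃ → IsComponent (M G Vk) Ω C₄ →
         Meets {n} {Vk} C₁ → Meets {n} {Vk} C₂ → Meets {n} {Vk} C₃ → Meets {n} {Vk} C₄ →
         (C₁ ≗ C₂) ⊎ (C₁ ≗ C₃) ⊎ (C₁ ≗ C₄) ⊎ (C₂ ≗ C₃) ⊎ (C₂ ≗ C₄) ⊎ (C₃ ≗ C₄)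
lemma4 G _ Vk _ _ Ω (H , minimal , clique , _) C₁ C₂ C₃ C₄ c₁ c₂ c₃ c₄
       (a₁ , a₁∈S , a₁∈C₁) (a₂ , a₂∈S , a₂∈C₂) (a₃ , a₃∈S , a₃∈C₃) (a₄ , a₄∈S , a₄∈C₄)
  with component-≗-or-avoids c₁ c₂ a₂∈C₂
... | inj₁ C₁≗C₂ = inj₁ C₁≗C₂
... | inj₂ a₂∉C₁ with component-≗-or-avoids c₁ c₃ a₃∈C₃
... | inj₁ C₁≗C₃ = inj₂ (inj₁ C₁≗C₃)
... | inj₂ a₃∉C₁ with component-≗-or-avoids c₁ c₄ a₄∈C₄
... | inj₁ C₁≗C₄ = inj₂ (inj₂ (inj₁ C₁≗C₄))
... | inj₂ a₄∉C₁ with component-≗-or-avoids c₂ c₃ a₃∈C₃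
... | inj₁ C₂≗C₃ = inj₂ (inj₂ (inj₂ (inj₁ C₂≗C₃)))
... | inj₂ a₃∉C₂ with component-≗-or-avoids c₂ c₄ a₄∈C₄
... | inj₁ C₂≗C₄ = inj₂ (inj₂ (inj₂ (inj₂ (inj₁ C₂≗C₄))))
... | inj₂ a₄∉C₂ with component-≗-or-avoids c₃ c₄ a₄∈C₄
... | inj₁ C₃≗C₄ = inj₂ (inj₂ (inj₂ (inj₂ (inj₂ C₃≗C₄))))
... | inj₂ a₄∉C₃ = ⊥-elim (no-four-separated-components G Vk {H} {Ω} minimal clique c₁ c₂ c₃ c₄ a₁∈S a₂∈S a₃∈S a₄∈S
                             a₁∈C₁ a₂∈C₂ a₃∈C₃ a₄∈C₄ a₂∉C₁ a₄∉C₃ a₃∉C₁ a₄∉C₁ a₃∉C₂ a₄∉C₂)
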